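{- Let $\mathbf{s}=(s_1,\dots,s_n)$ be a sequence of positive integers, $\mathbf{u}=(s_n,\dots,s_1)$, $\mathbf{s}^*=(s_1,\dots,s_n,1)$, $\mathbf{u}^*=(s_n,\dots,s_1,1)$. Let $\mathbf{r}\in\Psi_n$. Then for each $i$, \[\overline{\operatorname{REM}}_{\mathbf{s}^*}^{ -1}(\mathbf{r},0)\in\mathcal{L}^i(\operatorname{Par}_{\mathbf{s}^*})\iff\operatorname{REM}_{\mathbf{u}^*}^{ -1}(\operatorname{reverse}(\mathbf{r}),0)\in\mathcal{L}^i(\operatorname{Par}_{\mathbf{u}^*}).\]
   Context: $\langle N\rangle=\{0,\dots,N\}$, $\Psi_n=\langle s_1-1\rangle\times\cdots\times\langle s_n-1\rangle$. For a sequence $\mathbf{t}=(t_1,\dots,t_m)$ of positive integers, $\operatorname{Par}_{\mathbf{t}}=\{\sum_{j=1}^m c_j\mathbf{w}_j:0\le c_j<1\}\subset\mathbb{R}^m$ with $\mathbf{w}_j=(0,\dots,0,t_j,\dots,t_m)$ ($j-1$ leading zeros). $\operatorname{REM}_{\mathbf{t}}(\mathbf{x})=(y_1,\dots,y_m)$ with $y_i\in\{0,\dots,t_i-1\}$, $y_i\equiv x_i\pmod{t_i}$, and $\overline{\operatorname{REM}}_{\mathbf{t}}(\mathbf{x})=(z_1,\dots,z_m)$ with $z_i\in\{0,\dots,t_i-1\}$, $x_i+z_i\equiv0\pmod{t_i}$; both are bijections from $\operatorname{Par}_{\mathbf{t}}\cap\mathbb{Z}^m$ onto $\langle t_1-1\rangle\times\cdots\times\langle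 t_m-1\rangle$. $\operatorname{reverse}$ reverses a sequence. $\mathcal{L}^i(S)$ is the set of lattice points of $S$ whose last coordinate is $i$. -}

module Defs where

open import Data.Nat as ℕ using (ℕ; suc; _≤ᵇ_)
open import Data.Integer as ℤ using (ℤ; +_; _-_)
open import Data.Integer.Divisibility using () renaming (_∣_ to _∣ℤ_)
open import Data.Rational as ℚ using (ℚ; 0ℚ; 1ℚ)
open import Data.Fin using (Fin; toℕ)
open import Data.Vec using (Vec; lookup; tabulate; map; foldr; zipWith; replicate; last)
open import Data.Vec.Relation.Unary.All using (All)
open import Data.Bool using (if_then_else_)
open import Data.Product using (Σ; _×_)
open import Relation.Binary.PropositionalEquality using (_≡_)

ℤtoℚ : ℤ → ℚ
ℤtoℚ z = z ℚ./ 1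

ℕtoℚ : ℕ → ℚ
ℕtoℚ k = ℤtoℚ (+ k)

w : ∀ {m} → Vec ℕ m → Fin m → Vec ℚ m
w t j = tabulate (λ i → if toℕ j ≤ᵇ toℕ i then ℕtoℚ (lookup t i) else 0ℚ)

comb : ∀ {m} → Vec ℕ m → Vec ℚ m → Vec ℚ m
comb {m} t c =
  foldr (λ _ → Vec ℚ m) (zipWith ℚ._+_) (replicate m 0ℚ)
        (tabulate (λ j → map (ℚ._*_ (lookup c j)) (w t j)))

-- x ∈ Par_t (for a point with rational coordinates);
-- coefficients c_j ∈ [0,1).  For lattice points the c_j are forced to be rational,
-- so quantifying over ℚ instead of ℝ is equivalent.
InPar : ∀ {m} → Vec ℕ m → Vec ℚ m → Set
InPar {m} t x = Σ (Vec ℚ m) (λ c → All (λ cj → (0ℚ ℚ.≤ cj) × (cj ℚ.< 1ℚ)) c × (x ≡ comb t c))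

LatPar : ∀ {m} → Vec ℕ m → Vec ℤ m → Set
LatPar t x = InPar t (map ℤtoℚ x)

InL : ∀ {m} → ℤ → Vec ℕ (suc m) → Vec ℤ (suc m) → Set
InL i t x = LatPar t x × (last x ≡ i)

InBox : ∀ {m} → Vec ℕ m → Vec ℤ m → Set
InBox {m} t y = ∀ (k : Fin m) → (+ 0 ℤ.≤ lookup y k) × (lookup y k ℤ.< + lookup t k)

IsREM : ∀ {m} → Vec ℕ m → Vec ℤ m → Vec ℤ m → Set
IsREM {m} t x y = InBox t y × (∀ (k : Fin m) → (+ lookup t k) ∣ℤ (lookup x k - lookup y k))

IsREMbar : ∀ {m} → Vec ℕ m → Vec ℤ m → Vec ℤ m → Set
IsREMbar {m} t x z = InBox t z × (∀ (k : Fin m) → (+ lookup t k) ∣ℤ (lookup x k ℤ.+ lookup z k))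

module Submission where

-- A lattice point x of Par_t, t = (t_1,…,t_m), has coordinates x_i = t_i (c_1 + ⋯ + c_i)
-- with 0 ≤ c_j < 1.  Putting (t_0 , x_0) = (1 , 0), consecutive coordinate pairs satisfy
-- the integral step condition 0 ≤ t_{i-1} x_i − t_i x_{i-1} < t_{i-1} t_i, so a lattice
-- point of Par_t gives a chain (1,0), (t_1,x_1), …, (t_m,x_m) of steps.
-- Two facts about such chains carry the argument:
--   * uniqueness: a chain is determined by its first pair and by the residues x_i mod t_i
--     (this is the injectivity of REM_t on lattice points);
--   * reflection: (a , p) ↦ (a , a N − p) reverses steps, so a chain from (1,0) to (1,N)
--     read backwards and reflected is again a chain from (1,0) to (1,N).
-- If REMbar_{s*}(x) = (r , 0) and x has last coordinate N, reflecting the chain of x gives a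
-- chain for u* = (reverse s , 1) with residues (reverse r , 0) ending at height N.  By
-- uniqueness this is the chain of y, so x and y have the same last coordinate; the
-- corollary follows since the lattice conditions on x and y are hypotheses.

open import Defs
open import Data.Nat as ℕ using (ℕ; suc; zero; _<_)
import Data.Nat.Properties as ℕP
import Data.Nat.Divisibility as ℕD
open import Data.Integer as ℤ using (ℤ; +_)
import Data.Integer.Properties as ℤP
open import Data.Integer.Divisibility using () renaming (_∣_ to _∣ℤ_)
import Data.Integer.Divisibility.Signed as Signed
import Data.Integer.Solver as ℤSolver
open import Data.Rational as ℚ using (ℚ; 0ℚ; 1ℚ)
import Data.Rational.Properties as ℚP
import Data.Rational.Solver as ℚSolver
open import Data.Rational.Unnormalised as ℚᵘ using (mkℚᵘ; *≡*; *≤*; *<*) renaming (_≃_ to _≃ᵘ_)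
import Data.Rational.Unnormalised.Properties as ℚᵘP
open import Data.Fin using (Fin; zero; suc; toℕ)
open import Data.Bool using (if_then_else_)
open import Data.Vec as V using (Vec; []; _∷_; reverse; _∷ʳ_; lookup; tabulate; map; zipWith; initLast)
import Data.Vec.Properties as VP
open import Data.Vec.Relation.Unary.All using (All; []; _∷_)
open import Data.List as L using (List; [_])
import Data.List.Properties as LP
open import Data.List.Relation.Unary.Linked as Linked using (Linked; [-])
import Data.List.Relation.Unary.Linked.Properties as LinkedP
open import Data.List.Relation.Binary.Pointwise as PW using (Pointwise)
import Data.List.Relation.Binary.Pointwise.Properties as PWP
open import Data.Product using (_×_; _,_; proj₂)
open import Function using (flip)
open import Function.Bundles using (_⇔_; mk⇔)
open import Relation.Binary.PropositionalEquality hiding ([_])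
open import Relation.Nullary using (contradiction)

toℚᵘ-ℤtoℚ : ∀ z → ℚ.toℚᵘ (ℤtoℚ z) ≃ᵘ mkℚᵘ z 0
toℚᵘ-ℤtoℚ z = ℚP.toℚᵘ-fromℚᵘ (mkℚᵘ z 0)

ℤtoℚ-* : ∀ u v → ℤtoℚ (u ℤ.* v) ≡ ℤtoℚ u ℚ.* ℤtoℚ v
ℤtoℚ-* u v = ℚP.toℚᵘ-injective (begin
  ℚ.toℚᵘ (ℤtoℚ (u ℤ.* v))                  ≈⟨ toℚᵘ-ℤtoℚ (u ℤ.* v) ⟩
  mkℚᵘ u 0 ℚᵘ.* mkℚᵘ v 0                   ≈⟨ ℚᵘP.*-cong (ℚᵘP.≃-sym (toℚᵘ-ℤtoℚ u)) (ℚᵘP.≃-sym (toℚᵘ-ℤtoℚ v)) ⟩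
  ℚ.toℚᵘ (ℤtoℚ u) ℚᵘ.* ℚ.toℚᵘ (ℤtoℚ v)    ≈⟨ ℚᵘP.≃-sym (ℚP.toℚᵘ-homo-* (ℤtoℚ u) (ℤtoℚ v)) ⟩
  ℚ.toℚᵘ (ℤtoℚ u ℚ.* ℤtoℚ v)               ∎)
  where open ℚᵘP.≃-Reasoning

ℤtoℚ-- : ∀ u v → ℤtoℚ (u ℤ.- v) ≡ ℤtoℚ u ℚ.- ℤtoℚ v
ℤtoℚ-- u v = ℚP.toℚᵘ-injective (begin
  ℚ.toℚᵘ (ℤtoℚ (u ℤ.- v))                  ≈⟨ toℚᵘ-ℤtoℚ (u ℤ.- v) ⟩
  mkℚᵘ (u ℤ.- v) 0                         ≈⟨ *≡* (solve 2 (λ u v → (u :- v) :* con (+ 1) := (u :* con (+ 1) :+ (:- v) :* con (+ 1)) :* con (+ 1)) refl u v) ⟩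
  mkℚᵘ u 0 ℚᵘ.- mkℚᵘ v 0                   ≈⟨ ℚᵘP.+-cong (ℚᵘP.≃-sym (toℚᵘ-ℤtoℚ u)) (ℚᵘP.-‿cong (ℚᵘP.≃-sym (toℚᵘ-ℤtoℚ v))) ⟩
  ℚ.toℚᵘ (ℤtoℚ u) ℚᵘ.- ℚ.toℚᵘ (ℤtoℚ v)    ≈⟨ ℚᵘP.+-cong (ℚᵘP.≃-refl {ℚ.toℚᵘ (ℤtoℚ u)}) (ℚᵘP.≃-sym (ℚP.toℚᵘ-homo‿- (ℤtoℚ v))) ⟩
  ℚ.toℚᵘ (ℤtoℚ u) ℚᵘ.+ ℚ.toℚᵘ (ℚ.- ℤtoℚ v) ≈⟨ ℚᵘP.≃-sym (ℚP.toℚᵘ-homo-+ (ℤtoℚ u) (ℚ.- ℤtoℚ v)) ⟩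
  ℚ.toℚᵘ (ℤtoℚ u ℚ.- ℤtoℚ v)               ∎)
  where open ℚᵘP.≃-Reasoning
        open ℤSolver.+-*-Solver

ℤtoℚ-cancel-≤ : ∀ {u v} → ℤtoℚ u ℚ.≤ ℤtoℚ v → u ℤ.≤ v
ℤtoℚ-cancel-≤ {u} {v} le
  with ℚᵘP.≤-respʳ-≃ (toℚᵘ-ℤtoℚ v) (ℚᵘP.≤-respˡ-≃ (toℚᵘ-ℤtoℚ u) (ℚP.toℚᵘ-mono-≤ le))
... | *≤* u*1≤v*1 = subst₂ ℤ._≤_ (ℤP.*-identityʳ u) (ℤP.*-identityʳ v) u*1≤v*1

ℤtoℚ-cancel-< : ∀ {u v} → ℤtoℚ u ℚ.< ℤtoℚ v → u ℤ.< v
ℤtoℚ-cancel-< {u} {v} lt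
  with ℚᵘP.<-respʳ-≃ (toℚᵘ-ℤtoℚ v) (ℚᵘP.<-respˡ-≃ (toℚᵘ-ℤtoℚ u) (ℚP.toℚᵘ-mono-< lt))
... | *<* u*1<v*1 = subst₂ ℤ._<_ (ℤP.*-identityʳ u) (ℤP.*-identityʳ v) u*1<v*1

-- gap (a , p) (b , q) = a q − b p: for p = a P and q = b Q it equals a b (Q − P).
gap : ℕ × ℤ → ℕ × ℤ → ℤ
gap (a , p) (b , q) = + a ℤ.* q ℤ.- + b ℤ.* p

-- A step: with p = a P, the next value is q = b (P + c) for some c ∈ [0,1).
Step : ℕ × ℤ → ℕ × ℤ → Set
Step u@(a , _) v@(b , _) = + 0 ℤ.≤ gap u v × gap u v ℤ.< + (a ℕ.* b)

step-from-ℚ : ∀ {a b p q} {P c : ℚ} → 0 < a → 0 < b →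
  ℤtoℚ p ≡ ℕtoℚ a ℚ.* P → ℤtoℚ q ≡ ℕtoℚ b ℚ.* (P ℚ.+ c) →
  0ℚ ℚ.≤ c → c ℚ.< 1ℚ → Step (a , p) (b , q)
step-from-ℚ {a} {b} {p} {q} {P} {c} 0<a 0<b hp hq 0≤c c<1 =
  ℤtoℚ-cancel-≤ (subst₂ ℚ._≤_ (ℚP.*-zeroʳ K) (sym gap≡Kc) (ℚP.*-monoˡ-≤-nonNeg K 0≤c)) ,
  ℤtoℚ-cancel-< (subst₂ ℚ._<_ (sym gap≡Kc) (ℚP.*-identityʳ K) (ℚP.*-monoʳ-<-pos K c<1))
  where
  A = ℕtoℚ a
  B = ℕtoℚ b
  K = ℕtoℚ (a ℕ.* b)
  instance
    K-pos : ℚ.Positive K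
    K-pos = ℚP.normalize-pos (a ℕ.* b) 1 {{_}} {{ℕ.>-nonZero (ℕP.*-mono-< 0<a 0<b)}}
    K-nonNeg : ℚ.NonNegative K
    K-nonNeg = ℚP.pos⇒nonNeg K
  K≡AB : K ≡ A ℚ.* B
  K≡AB = trans (cong ℤtoℚ (ℤP.pos-* a b)) (ℤtoℚ-* (+ a) (+ b))
  gap≡Kc : ℤtoℚ (gap (a , p) (b , q)) ≡ K ℚ.* c
  gap≡Kc = begin
    ℤtoℚ (+ a ℤ.* q ℤ.- + b ℤ.* p)               ≡⟨ ℤtoℚ-- (+ a ℤ.* q) (+ b ℤ.* p) ⟩
    ℤtoℚ (+ a ℤ.* q) ℚ.- ℤtoℚ (+ b ℤ.* p)        ≡⟨ cong₂ ℚ._-_ (ℤtoℚ-* (+ a) q) (ℤtoℚ-* (+ b) p) ⟩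
    A ℚ.* ℤtoℚ q ℚ.- B ℚ.* ℤtoℚ p                 ≡⟨ cong₂ (λ u v → A ℚ.* u ℚ.- B ℚ.* v) hq hp ⟩
    A ℚ.* (B ℚ.* (P ℚ.+ c)) ℚ.- B ℚ.* (A ℚ.* P)  ≡⟨ solve 4 (λ A B P c → A :* (B :* (P :+ c)) :- B :* (A :* P) := (A :* B) :* c) refl A B P c ⟩
    (A ℚ.* B) ℚ.* c                               ≡⟨ cong (ℚ._* c) (sym K≡AB) ⟩
    K ℚ.* c                                       ∎
    where open ≡-Reasoning
          open ℚSolver.+-*-Solver

distance-< : ∀ {i j K} → + 0 ℤ.≤ i → i ℤ.< + K → + 0 ℤ.≤ j → j ℤ.< + K → ℤ.∣ i ℤ.- j ∣ < K
distance-< {+ m} {+ n} {K} _ (ℤ.+<+ m<K) _ (ℤ.+<+ n<K) = begin-strict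
  ℤ.∣ + m ℤ.- + n ∣ ≡⟨ cong ℤ.∣_∣ (ℤP.[+m]-[+n]≡m⊖n m n) ⟩
  ℤ.∣ m ℤ.⊖ n ∣     ≤⟨ ℤP.∣m⊝n∣≤m⊔n m n ⟩
  m ℕ.⊔ n           <⟨ ℕP.⊔-lub m<K n<K ⟩
  K                 ∎
  where open ℕP.≤-Reasoning

multiple-below⇒0 : ∀ {b k} → b ℕD.∣ k → k < b → k ≡ 0
multiple-below⇒0 {k = zero}  _   _   = refl
multiple-below⇒0 {k = suc k} b∣k k<b = contradiction b∣k (ℕD.>⇒∤ k<b)

-- Uniqueness of a step: from a fixed (a , p) at most one q in each residue class mod b
-- can be reached, since a (q − q') is the difference of two gaps in [0 , a b).
step-unique : ∀ {u b q q'} → Step u (b , q) → Step u (b , q') → + b ∣ℤ (q ℤ.- q') → q ≡ q'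
step-unique {a , p} {b} {q} {q'} (0≤g , g<ab) (0≤g' , g'<ab) b∣q-q' =
  ℤP.i-j≡0⇒i≡j q q' (ℤP.∣i∣≡0⇒i≡0 (multiple-below⇒0 b∣q-q' ∣q-q'∣<b))
  where
  difference : + a ℤ.* (q ℤ.- q') ≡ gap (a , p) (b , q) ℤ.- gap (a , p) (b , q')
  difference = solve 5 (λ A B P Q Q' → A :* (Q :- Q') := (A :* Q :- B :* P) :- (A :* Q' :- B :* P)) refl (+ a) (+ b) p q q'
    where open ℤSolver.+-*-Solver
  ∣q-q'∣<b : ℤ.∣ q ℤ.- q' ∣ < b
  ∣q-q'∣<b = ℕP.*-cancelˡ-< a _ _ (begin-strict
    a ℕ.* ℤ.∣ q ℤ.- q' ∣                               ≡⟨ sym (ℤP.abs-* (+ a) (q ℤ.- q')) ⟩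
    ℤ.∣ + a ℤ.* (q ℤ.- q') ∣                           ≡⟨ cong ℤ.∣_∣ difference ⟩
    ℤ.∣ gap (a , p) (b , q) ℤ.- gap (a , p) (b , q') ∣ <⟨ distance-< 0≤g g<ab 0≤g' g'<ab ⟩
    a ℕ.* b                                            ∎)
    where open ℕP.≤-Reasoning

reflect : ℤ → ℕ × ℤ → ℕ × ℤ
reflect N (a , p) = (a , + a ℤ.* N ℤ.- p)

-- Reflection preserves gaps while swapping their ends, hence reverses steps.
reflect-step : ∀ N {u v} → Step v u → Step (reflect N u) (reflect N v)
reflect-step N {a , p} {b , q} (0≤g , g<ba) =
  subst (+ 0 ℤ.≤_) same-gap 0≤g , subst₂ ℤ._<_ same-gap (cong +_ (ℕP.*-comm b a)) g<ba
  where
  same-gap : gap (b , q) (a , p) ≡ gap (reflect N (a , p)) (reflect N (b , q))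
  same-gap = solve 5 (λ A B N P Q → B :* P :- A :* Q := A :* (B :* N :- Q) :- B :* (A :* N :- P)) refl (+ a) (+ b) N p q
    where open ℤSolver.+-*-Solver

reflect-top : ∀ N → reflect N (1 , N) ≡ (1 , + 0)
reflect-top N = cong (1 ,_) (trans (cong (ℤ._- N) (ℤP.*-identityˡ N)) (ℤP.+-inverseʳ N))

reflect-bottom : ∀ N → reflect N (1 , + 0) ≡ (1 , N)
reflect-bottom N = cong (1 ,_) (trans (ℤP.+-identityʳ (+ 1 ℤ.* N)) (ℤP.*-identityˡ N))

linked-∷ʳ : ∀ {A : Set} {R : A → A → Set} xs {y z} →
  Linked R (xs L.∷ʳ y) → R y z → Linked R (xs L.∷ʳ y L.∷ʳ z)
linked-∷ʳ L.[]                 _          Ryz = Ryz Linked.∷ [-]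
linked-∷ʳ (x L.∷ L.[])         (Rxy Linked.∷ _) Ryz = Rxy Linked.∷ Ryz Linked.∷ [-]
linked-∷ʳ (x L.∷ x' L.∷ xs)    (Rxx' Linked.∷ l) Ryz = Rxx' Linked.∷ linked-∷ʳ (x' L.∷ xs) l Ryz

linked-reverse : ∀ {A : Set} {R : A → A → Set} {xs} → Linked R xs → Linked (flip R) (L.reverse xs)
linked-reverse Linked.[] = Linked.[]
linked-reverse [-] = [-]
linked-reverse {R = R} {x L.∷ y L.∷ ys} (Rxy Linked.∷ l) =
  subst (Linked (flip R)) (sym (LP.unfold-reverse x (y L.∷ ys)))
    (subst (λ zs → Linked (flip R) (zs L.∷ʳ x)) (sym (LP.unfold-reverse y ys))
      (linked-∷ʳ (L.reverse ys) (subst (Linked (flip R)) (LP.unfold-reverse y ys) (linked-reverse l)) Rxy))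

mirror : ∀ N As → Linked Step ((1 , + 0) L.∷ As L.∷ʳ (1 , N)) →
  Linked Step ((1 , + 0) L.∷ L.map (reflect N) (L.reverse As) L.∷ʳ (1 , N))
mirror N As chain = subst₂ (λ u v → Linked Step (u L.∷ L.map (reflect N) (L.reverse As) L.∷ʳ v))
  (reflect-top N) (reflect-bottom N) reflected
  where
  backwards : Linked (flip Step) ((1 , N) L.∷ L.reverse As L.∷ʳ (1 , + 0))
  backwards = subst (λ zs → Linked (flip Step) (zs L.∷ʳ (1 , + 0))) (LP.reverse-++ As [ (1 , N) ])
    (subst (Linked (flip Step)) (LP.unfold-reverse (1 , + 0) (As L.∷ʳ (1 , N))) (linked-reverse chain))
  reflected : Linked Step (reflect N (1 , N) L.∷ L.map (reflect N) (L.reverse As) L.∷ʳ reflect N (1 , + 0))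
  reflected = subst (Linked Step) (LP.map-++ (reflect N) ((1 , N) L.∷ L.reverse As) [ (1 , + 0) ])
    (LinkedP.map⁺ (Linked.map (λ {u} {v} → reflect-step N {u} {v}) backwards))

_≡ₘ_ : ℕ × ℤ → ℕ × ℤ → Set
(a , p) ≡ₘ (b , q) = a ≡ b × + a ∣ℤ (p ℤ.- q)

chain-unique : ∀ h {L₁ L₂} → Linked Step (h L.∷ L₁) → Linked Step (h L.∷ L₂) →
  Pointwise _≡ₘ_ L₁ L₂ → L₁ ≡ L₂
chain-unique h [-] [-] PW.[] = refl
chain-unique h {(a , p) L.∷ L₁} {(.a , q) L.∷ L₂} (s₁ Linked.∷ l₁) (s₂ Linked.∷ l₂) ((refl , a∣p-q) PW.∷ pw)
  with step-unique {u = h} {q = p} {q' = q} s₁ s₂ a∣p-q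
... | refl = cong ((a , p) L.∷_) (chain-unique (a , p) l₁ l₂ pw)

pairs : ∀ {m} → Vec ℕ m → Vec ℤ m → List (ℕ × ℤ)
pairs []       []       = L.[]
pairs (a ∷ t) (p ∷ x) = (a , p) L.∷ pairs t x

pairs-∷ʳ : ∀ {m} (t : Vec ℕ m) (x : Vec ℤ m) a p → pairs (t ∷ʳ a) (x ∷ʳ p) ≡ pairs t x L.∷ʳ (a , p)
pairs-∷ʳ []      []      a p = refl
pairs-∷ʳ (b ∷ t) (q ∷ x) a p = cong ((b , q) L.∷_) (pairs-∷ʳ t x a p)

pairs-reverse : ∀ {m} (t : Vec ℕ m) (x : Vec ℤ m) → pairs (reverse t) (reverse x) ≡ L.reverse (pairs t x)
pairs-reverse []      []      = refl
pairs-reverse (a ∷ t) (p ∷ x) = begin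
  pairs (reverse (a ∷ t)) (reverse (p ∷ x)) ≡⟨ cong₂ pairs (VP.reverse-∷ a t) (VP.reverse-∷ p x) ⟩
  pairs (reverse t ∷ʳ a) (reverse x ∷ʳ p)   ≡⟨ pairs-∷ʳ (reverse t) (reverse x) a p ⟩
  pairs (reverse t) (reverse x) L.∷ʳ (a , p) ≡⟨ cong (L._∷ʳ (a , p)) (pairs-reverse t x) ⟩
  L.reverse (pairs t x) L.∷ʳ (a , p)        ≡⟨ sym (LP.unfold-reverse (a , p) (pairs t x)) ⟩
  L.reverse (pairs (a ∷ t) (p ∷ x))         ∎
  where open ≡-Reasoning

SameModulus : (ℕ → ℤ → ℤ → Set) → ℕ × ℤ → ℕ × ℤ → Set
SameModulus Rel (a , p) (b , q) = a ≡ b × Rel a p q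

pairs-init : ∀ (Rel : ℕ → ℤ → ℤ → Set) {m} (t : Vec ℕ m) (x z : Vec ℤ m) {a p q} →
  (∀ k → Rel (lookup (t ∷ʳ a) k) (lookup (x ∷ʳ p) k) (lookup (z ∷ʳ q) k)) →
  Pointwise (SameModulus Rel) (pairs t x) (pairs t z)
pairs-init Rel []      []      []      _    = PW.[]
pairs-init Rel (b ∷ t) (y ∷ x) (w ∷ z) rels = (refl , rels zero) PW.∷ pairs-init Rel t x z (λ k → rels (suc k))

All-∷ʳ : ∀ {A : Set} {P : A → Set} {m} (v : Vec A m) {a} → All P v → P a → All P (v ∷ʳ a)
All-∷ʳ []      []         pa = pa ∷ []
All-∷ʳ (x ∷ v) (px ∷ pv) pa = px ∷ All-∷ʳ v pv pa

All-reverse : ∀ {A : Set} {P : A → Set} {m} (v : Vec A m) → All P v → All P (reverse v)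
All-reverse []      []        = []
All-reverse (x ∷ v) (px ∷ pv) = subst (All _) (sym (VP.reverse-∷ x v)) (All-∷ʳ (reverse v) (All-reverse v pv) px)

vsum : ∀ {k} m → Vec (Vec ℚ m) k → Vec ℚ m
vsum m = V.foldr (λ _ → Vec ℚ m) (zipWith ℚ._+_) (V.replicate m 0ℚ)

vsum-zeros : ∀ {k m} (F : Fin k → Vec ℚ m) → vsum (suc m) (tabulate (λ j → 0ℚ ∷ F j)) ≡ 0ℚ ∷ vsum m (tabulate F)
vsum-zeros {zero}  F = refl
vsum-zeros {suc k} F = cong (zipWith ℚ._+_ (0ℚ ∷ F zero)) (vsum-zeros (λ j → F (suc j)))

≤ᵇ-suc : ∀ m n → (suc m ℕ.≤ᵇ suc n) ≡ (m ℕ.≤ᵇ n)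
≤ᵇ-suc zero    n = refl
≤ᵇ-suc (suc m) n = refl

w-zero : ∀ {m} (t : Vec ℕ (suc m)) → w t zero ≡ map ℕtoℚ t
w-zero t = trans (VP.tabulate-∘ ℕtoℚ (lookup t)) (cong (map ℕtoℚ) (VP.tabulate∘lookup t))

w-suc : ∀ {m} a (t : Vec ℕ m) j → w (a ∷ t) (suc j) ≡ 0ℚ ∷ w t j
w-suc a t j = cong (0ℚ ∷_) (VP.tabulate-cong λ i →
  cong (λ b → if b then ℕtoℚ (lookup t i) else 0ℚ) (≤ᵇ-suc (toℕ j) (toℕ i)))

comb-∷ : ∀ {m} a (t : Vec ℕ m) c cs →
  comb (a ∷ t) (c ∷ cs) ≡ (c ℚ.* ℕtoℚ a ℚ.+ 0ℚ) ∷ zipWith ℚ._+_ (map (λ b → c ℚ.* ℕtoℚ b) t) (comb t cs)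
comb-∷ {m} a t c cs = begin
  zipWith ℚ._+_ (map (c ℚ.*_) (w (a ∷ t) zero)) (vsum (suc m) (tabulate (λ j → map (lookup cs j ℚ.*_) (w (a ∷ t) (suc j)))))
    ≡⟨ cong₂ (λ u v → zipWith ℚ._+_ (map (c ℚ.*_) u) (vsum (suc m) v)) (w-zero (a ∷ t)) (VP.tabulate-cong head-zero) ⟩
  zipWith ℚ._+_ (map (c ℚ.*_) (map ℕtoℚ (a ∷ t))) (vsum (suc m) (tabulate (λ j → 0ℚ ∷ map (lookup cs j ℚ.*_) (w t j))))
    ≡⟨ cong (zipWith ℚ._+_ (map (c ℚ.*_) (map ℕtoℚ (a ∷ t)))) (vsum-zeros (λ j → map (lookup cs j ℚ.*_) (w t j))) ⟩
  (c ℚ.* ℕtoℚ a ℚ.+ 0ℚ) ∷ zipWith ℚ._+_ (map (c ℚ.*_) (map ℕtoℚ t)) (comb t cs)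
    ≡⟨ cong (λ u → (c ℚ.* ℕtoℚ a ℚ.+ 0ℚ) ∷ zipWith ℚ._+_ u (comb t cs)) (sym (VP.map-∘ (c ℚ.*_) ℕtoℚ t)) ⟩
  (c ℚ.* ℕtoℚ a ℚ.+ 0ℚ) ∷ zipWith ℚ._+_ (map (λ b → c ℚ.* ℕtoℚ b) t) (comb t cs) ∎
  where
  open ≡-Reasoning
  head-zero : ∀ j → map (lookup cs j ℚ.*_) (w (a ∷ t) (suc j)) ≡ 0ℚ ∷ map (lookup cs j ℚ.*_) (w t j)
  head-zero j = trans (cong (map (lookup cs j ℚ.*_)) (w-suc a t j))
                      (cong (_∷ map (lookup cs j ℚ.*_) (w t j)) (ℚP.*-zeroʳ (lookup cs j)))

partialSums : ∀ {m} → Vec ℕ m → ℚ → Vec ℚ m → Vec ℚ m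
partialSums []      P []       = []
partialSums (a ∷ t) P (c ∷ cs) = ℕtoℚ a ℚ.* (P ℚ.+ c) ∷ partialSums t (P ℚ.+ c) cs

zipWith-map-+ : ∀ {A : Set} {m} (f g : A → ℚ) (xs : Vec A m) (v : Vec ℚ m) →
  zipWith ℚ._+_ (map f xs) (zipWith ℚ._+_ (map g xs) v) ≡ zipWith ℚ._+_ (map (λ b → f b ℚ.+ g b) xs) v
zipWith-map-+ f g []       []      = refl
zipWith-map-+ f g (x ∷ xs) (y ∷ v) = cong₂ _∷_ (sym (ℚP.+-assoc (f x) (g x) y)) (zipWith-map-+ f g xs v)

comb-shift : ∀ {m} (t : Vec ℕ m) P c → zipWith ℚ._+_ (map (λ b → ℕtoℚ b ℚ.* P) t) (comb t c) ≡ partialSums t P c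
comb-shift []      P []       = refl
comb-shift (a ∷ t) P (c ∷ cs) rewrite comb-∷ a t c cs = cong₂ _∷_
  (solve 3 (λ A P c → A :* P :+ (c :* A :+ con 0ℚ) := A :* (P :+ c)) refl (ℕtoℚ a) P c)
  (begin
    zipWith ℚ._+_ (map (λ b → ℕtoℚ b ℚ.* P) t) (zipWith ℚ._+_ (map (λ b → c ℚ.* ℕtoℚ b) t) (comb t cs))
      ≡⟨ zipWith-map-+ (λ b → ℕtoℚ b ℚ.* P) (λ b → c ℚ.* ℕtoℚ b) t (comb t cs) ⟩
    zipWith ℚ._+_ (map (λ b → ℕtoℚ b ℚ.* P ℚ.+ c ℚ.* ℕtoℚ b) t) (comb t cs)
      ≡⟨ cong (λ u → zipWith ℚ._+_ u (comb t cs)) (VP.map-cong (λ b → solve 3 (λ B P c → B :* P :+ c :* B := B :* (P :+ c)) refl (ℕtoℚ b) P c) t) ⟩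
    zipWith ℚ._+_ (map (λ b → ℕtoℚ b ℚ.* (P ℚ.+ c)) t) (comb t cs)
      ≡⟨ comb-shift t (P ℚ.+ c) cs ⟩
    partialSums t (P ℚ.+ c) cs ∎)
  where open ℚSolver.+-*-Solver
        open ≡-Reasoning

comb-partialSums : ∀ {m} (t : Vec ℕ m) c → comb t c ≡ partialSums t 0ℚ c
comb-partialSums t c = trans (sym (no-shift t (comb t c))) (comb-shift t 0ℚ c)
  where
  no-shift : ∀ {k} (t : Vec ℕ k) v → zipWith ℚ._+_ (map (λ b → ℕtoℚ b ℚ.* 0ℚ) t) v ≡ v
  no-shift []      []      = refl
  no-shift (a ∷ t) (y ∷ v) = cong₂ _∷_ (trans (cong (ℚ._+ y) (ℚP.*-zeroʳ (ℕtoℚ a))) (ℚP.+-identityˡ y)) (no-shift t v)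

InUnit : ℚ → Set
InUnit c = 0ℚ ℚ.≤ c × c ℚ.< 1ℚ

partialSums-chain : ∀ {m a p P} → 0 < a → ℤtoℚ p ≡ ℕtoℚ a ℚ.* P →
  (t : Vec ℕ m) → All (0 <_) t → (x : Vec ℤ m) (c : Vec ℚ m) → All InUnit c →
  map ℤtoℚ x ≡ partialSums t P c → Linked Step ((a , p) L.∷ pairs t x)
partialSums-chain _ _ [] [] [] [] [] _ = [-]
partialSums-chain 0<a hp (b ∷ t) (0<b ∷ pos) (q ∷ x) (c ∷ cs) ((0≤c , c<1) ∷ bounds) eq =
  step-from-ℚ 0<a 0<b hp hq 0≤c c<1 Linked.∷ partialSums-chain 0<b hq t pos x cs bounds (VP.∷-injectiveʳ eq)
  where hq = VP.∷-injectiveˡ eq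

lattice-chain : ∀ {m} (t : Vec ℕ m) → All (0 <_) t → (x : Vec ℤ m) → LatPar t x →
  Linked Step ((1 , + 0) L.∷ pairs t x)
lattice-chain t pos x (c , bounds , x≡comb) =
  partialSums-chain (ℕ.s≤s ℕ.z≤n) (sym (ℚP.*-zeroʳ (ℕtoℚ 1))) t pos x c bounds (trans x≡comb (comb-partialSums t c))

_≡ₘ⁻_ : ℕ × ℤ → ℕ × ℤ → Set
(a , p) ≡ₘ⁻ (b , r) = a ≡ b × + a ∣ℤ (p ℤ.+ r)

≡ₘ-sym : ∀ {u v} → u ≡ₘ v → v ≡ₘ u
≡ₘ-sym {a , p} {.a , q} (refl , a∣p-q) = refl , subst (a ℕD.∣_) (ℤP.∣i-j∣≡∣j-i∣ p q) a∣p-q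

≡ₘ-trans : ∀ {u v w} → u ≡ₘ v → v ≡ₘ w → u ≡ₘ w
≡ₘ-trans {a , p} {.a , q} {.a , r} (refl , a∣p-q) (refl , a∣q-r) = refl ,
  Signed.∣⇒∣ᵤ (subst (Signed._∣_ (+ a)) (solve 3 (λ p q r → (p :- q) :+ (q :- r) := p :- r) refl p q r)
    (Signed.∣m∣n⇒∣m+n (Signed.∣ᵤ⇒∣ {+ a} {p ℤ.- q} a∣p-q) (Signed.∣ᵤ⇒∣ {+ a} {q ℤ.- r} a∣q-r)))
  where open ℤSolver.+-*-Solver

reflect-≡ₘ⁻ : ∀ N {u v} → u ≡ₘ⁻ v → reflect N u ≡ₘ v
reflect-≡ₘ⁻ N {a , p} {.a , r} (refl , a∣p+r) = refl ,
  Signed.∣⇒∣ᵤ (subst (Signed._∣_ (+ a)) (solve 4 (λ A N p r → A :* N :- (p :+ r) := (A :* N :- p) :- r) refl (+ a) N p r)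
    (Signed.∣m∣n⇒∣m-n (Signed.∣m⇒∣m*n N Signed.∣-refl) (Signed.∣ᵤ⇒∣ {+ a} {p ℤ.+ r} a∣p+r)))
  where open ℤSolver.+-*-Solver

heights-agree : ∀ As Bs Rs {N M} →
  Linked Step ((1 , + 0) L.∷ As L.∷ʳ (1 , N)) → Linked Step ((1 , + 0) L.∷ Bs L.∷ʳ (1 , M)) →
  Pointwise _≡ₘ⁻_ As Rs → Pointwise _≡ₘ_ Bs (L.reverse Rs) → N ≡ M
heights-agree As Bs Rs {N} {M} chainA chainB As≡-Rs Bs≡revRs =
  cong proj₂ (LP.∷ʳ-injectiveʳ (L.map (reflect N) (L.reverse As)) Bs
    (chain-unique (1 , + 0) (mirror N As chainA) chainB (PW.++⁺ mirrored≡Bs ((refl , ℕD.1∣ _) PW.∷ PW.[]))))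
  where
  mirrored≡Bs : Pointwise _≡ₘ_ (L.map (reflect N) (L.reverse As)) Bs
  mirrored≡Bs = PWP.transitive (λ {u} {v} {w} → ≡ₘ-trans {u} {v} {w})
    (subst (Pointwise _≡ₘ_ _) (LP.map-id (L.reverse Rs))
      (PW.map⁺ (reflect N) (λ r → r) (PWP.reflexive (λ {u} {v} → reflect-≡ₘ⁻ N {u} {v}) (PW.reverse⁺ As≡-Rs))))
    (PWP.symmetric (λ {u} {v} → ≡ₘ-sym {u} {v}) Bs≡revRs)

last-agree : (n : ℕ) (s : Vec ℕ n) → All (0 <_) s → (r : Vec ℤ n) →
  (x : Vec ℤ (suc n)) → LatPar (s ∷ʳ 1) x → IsREMbar (s ∷ʳ 1) x (r ∷ʳ + 0) →
  (y : Vec ℤ (suc n)) → LatPar (reverse s ∷ʳ 1) y → IsREM (reverse s ∷ʳ 1) y (reverse r ∷ʳ + 0) →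
  V.last x ≡ V.last y
last-agree n s spos r x latx (_ , x≡-r) y laty (_ , y≡revr) with initLast x | initLast y
... | xs , N , refl | ys , M , refl = heights-agree (pairs s xs) (pairs (reverse s) ys) (pairs s r)
  (subst (λ L → Linked Step ((1 , + 0) L.∷ L)) (pairs-∷ʳ s xs 1 N)
    (lattice-chain (s ∷ʳ 1) (All-∷ʳ s spos (ℕ.s≤s ℕ.z≤n)) (xs ∷ʳ N) latx))
  (subst (λ L → Linked Step ((1 , + 0) L.∷ L)) (pairs-∷ʳ (reverse s) ys 1 M)
    (lattice-chain (reverse s ∷ʳ 1) (All-∷ʳ (reverse s) (All-reverse s spos) (ℕ.s≤s ℕ.z≤n)) (ys ∷ʳ M) laty))
  (pairs-init (λ a p q → + a ∣ℤ (p ℤ.+ q)) s xs r x≡-r)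
  (subst (Pointwise _≡ₘ_ _) (pairs-reverse s r) (pairs-init (λ a p q → + a ∣ℤ (p ℤ.- q)) (reverse s) ys (reverse r) y≡revr))

corollary5p9 : (n : ℕ) (s : Vec ℕ n) → All (0 <_) s →
    (r : Vec ℤ n) → InBox s r →
    (x : Vec ℤ (suc n)) → LatPar (s ∷ʳ 1) x → IsREMbar (s ∷ʳ 1) x (r ∷ʳ + 0) →
    (y : Vec ℤ (suc n)) → LatPar (reverse s ∷ʳ 1) y → IsREM (reverse s ∷ʳ 1) y (reverse r ∷ʳ + 0) →
    (i : ℤ) → InL i (s ∷ʳ 1) x ⇔ InL i (reverse s ∷ʳ 1) y
corollary5p9 n s spos r _ x latx xRes y laty yRes i =
  mk⇔ (λ { (_ , last-x≡i) → laty , trans (sym same-last) last-x≡i })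
      (λ { (_ , last-y≡i) → latx , trans same-last last-y≡i })
  where
  same-last : V.last x ≡ V.last y
  same-last = last-agree n s spos r x latx xRes y laty yRes
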